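{- Let $A$ be a unital associative algebra, $x,y\in A$, and $\sigma:A\to A$ a (unital) algebra homomorphism. Then for all $n\in\mathbb{N}$, $$(x+y)^n=\sum_{k=0}^n\widehat{\mathcal{SH}}_{k,n-k}(1)\,x^{n-k},$$ where $\widehat{\mathcal{SH}}_{k,n-k}:=\mathcal{SH}_{k,n-k}(\operatorname{ad}_\sigma x+y,\ \sigma)$.
   Context: $\operatorname{ad}_\sigma x:A\to A$ is the linear map $\operatorname{ad}_\sigma x(a)=xa-\sigma(a)x$, and $\operatorname{ad}_\sigma x+y$ denotes the linear map $a\mapsto xa-\sigma(a)x+ya$. For linear operators $P,Q$ on $A$, $\mathcal{SH}_{k,l}(P,Q)$ is the linear operator given by the sum of all compositions of $k$ copies of $P$ and $l$ copies of $Q$ in all possible orders (i.e., the sum of all words with exactly $k$ letters $P$ and $l$ letters $Q$, evaluated by composition); $\mathcal{SH}_{0,0}=\mathrm{id}_A$. -}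

module Defs where

open import Level using (_⊔_)
open import Data.Nat using (ℕ; zero; suc; _∸_)
open import Data.Bool using (Bool; true; false)
open import Data.List using (List; []; _∷_; map; _++_; foldr; upTo)
open import Algebra.Bundles using (Ring)
import Algebra.Bundles
import Algebra.Definitions.RawSemiring as RawSemiringDefs

-- All words with exactly k letters "true" (standing for P) and l letters
-- "false" (standing for Q), each word listed exactly once.
words : ℕ → ℕ → List (List Bool)
words zero    zero    = [] ∷ []
words (suc k) zero    = map (true ∷_) (words k zero)
words zero    (suc l) = map (false ∷_) (words zero l)
words (suc k) (suc l) = map (true ∷_) (words k (suc l)) ++ map (false ∷_) (words (suc k) l)

module _ {c ℓ} (R : Ring c ℓ) where
  open Ring R

  pow : Carrier → ℕ → Carrier
  pow = RawSemiringDefs._^_ (Algebra.Bundles.Semiring.rawSemiring semiring)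

  evalWord : (Carrier → Carrier) → (Carrier → Carrier) → List Bool → Carrier → Carrier
  evalWord P Q []          a = a
  evalWord P Q (true ∷ w)  a = P (evalWord P Q w a)
  evalWord P Q (false ∷ w) a = Q (evalWord P Q w a)

  SH : ℕ → ℕ → (Carrier → Carrier) → (Carrier → Carrier) → Carrier → Carrier
  SH k l P Q a = foldr (λ w s → evalWord P Q w a + s) 0# (words k l)

  adσ+ : (Carrier → Carrier) → Carrier → Carrier → Carrier → Carrier
  adσ+ σ x y a = x * a - σ a * x + y * a

  sumTo : ℕ → (ℕ → Carrier) → Carrier
  sumTo n f = foldr (λ k s → f k + s) 0# (upTo (suc n))

-- Write D = ad_σ x + y. The identity (x + y) a = D a + σ(a) x splits left
-- multiplication by x + y into two additive operators on the coefficient a: D,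
-- and σ, which also releases one factor x to the right. Hence
-- (x + y)^n a = Σ_{k+l=n} SH_{k,l}(D, σ)(a) x^l by induction on n: splitting the
-- words of SH_{k,l} by their first letter gives the Pascal-type recurrence
-- SH_{k+1,l+1} = D SH_{k,l+1} + σ SH_{k+1,l}, which is exactly what the induction
-- step produces.
module Submission where

open import Defs
open import Data.Nat using (ℕ; zero; suc; _∸_)
import Data.Nat as ℕ
open import Data.Bool using (Bool; true; false)
open import Data.List using (List; []; _∷_; map; _++_; foldr; upTo)
open import Data.List.Properties using (map-upTo)
open import Level using (_⊔_)
open import Function using (_∘_)
open import Relation.Binary.PropositionalEquality as ≡ using (_≡_)
open import Algebra.Bundles using (Ring)
open import Algebra.Morphism.Structures using (module MonoidMorphisms; module RingMorphisms)
import Algebra.Properties.Ring as RingProperties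
import Algebra.Properties.CommutativeSemigroup as CommutativeSemigroupProperties
import Relation.Binary.Reasoning.Setoid as SetoidReasoning

module _ {c ℓ} (R : Ring c ℓ) where
  open Ring R hiding (zero)
  open RingProperties R using (-‿+-comm)
  open CommutativeSemigroupProperties +-commutativeSemigroup
    using (interchange; xy∙z≈xz∙y)
  open SetoidReasoning setoid

  IsAdditive : (Carrier → Carrier) → Set (c ⊔ ℓ)
  IsAdditive = MonoidMorphisms.IsMonoidHomomorphism +-rawMonoid +-rawMonoid

  module Additive = MonoidMorphisms.IsMonoidHomomorphism

  ∑ : ∀ {a} {A : Set a} → (A → Carrier) → List A → Carrier
  ∑ f = foldr (λ w s → f w + s) 0#

  ∑-++ : ∀ {a} {A : Set a} (f : A → Carrier) xs ys → ∑ f (xs ++ ys) ≈ ∑ f xs + ∑ f ys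
  ∑-++ f []       ys = sym (+-identityˡ _)
  ∑-++ f (w ∷ xs) ys = trans (+-congˡ (∑-++ f xs ys)) (sym (+-assoc _ _ _))

  ∑-map : ∀ {a b} {A : Set a} {B : Set b} (f : B → Carrier) (g : A → B) xs →
          ∑ f (map g xs) ≡ ∑ (f ∘ g) xs
  ∑-map f g []       = ≡.refl
  ∑-map f g (w ∷ xs) = ≡.cong (f (g w) +_) (∑-map f g xs)

  additive-∑ : ∀ {P} → IsAdditive P → ∀ {a} {A : Set a} (f : A → Carrier) xs →
               P (∑ f xs) ≈ ∑ (P ∘ f) xs
  additive-∑ P-additive f []       = Additive.ε-homo P-additive
  additive-∑ P-additive f (w ∷ xs) =
    trans (Additive.homo P-additive _ _) (+-congˡ (additive-∑ P-additive f xs))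

  sumTo-suc : ∀ n f → sumTo R (suc n) f ≡ f 0 + sumTo R n (f ∘ suc)
  sumTo-suc n f = ≡.cong (f 0 +_)
    (≡.trans (≡.cong (∑ f) (≡.sym (map-upTo suc (suc n)))) (∑-map f suc (upTo (suc n))))

  antidiagonal : ℕ → (ℕ → ℕ → Carrier) → Carrier
  antidiagonal zero    F = F 0 0
  antidiagonal (suc n) F = F 0 (suc n) + antidiagonal n (F ∘ suc)

  sumTo-antidiagonal : ∀ n F → sumTo R n (λ k → F k (n ∸ k)) ≈ antidiagonal n F
  sumTo-antidiagonal zero    F = +-identityʳ _
  sumTo-antidiagonal (suc n) F = begin
    sumTo R (suc n) (λ k → F k (suc n ∸ k))           ≡⟨ sumTo-suc n _ ⟩
    F 0 (suc n) + sumTo R n (λ k → F (suc k) (n ∸ k))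
      ≈⟨ +-congˡ (sumTo-antidiagonal n (F ∘ suc)) ⟩
    antidiagonal (suc n) F                            ∎

  antidiagonal-cong : ∀ n {F G} → (∀ k l → k ℕ.+ l ≡ n → F k l ≈ G k l) →
                      antidiagonal n F ≈ antidiagonal n G
  antidiagonal-cong zero    F≈G = F≈G 0 0 ≡.refl
  antidiagonal-cong (suc n) F≈G =
    +-cong (F≈G 0 (suc n) ≡.refl)
           (antidiagonal-cong n (λ k l k+l≡n → F≈G (suc k) l (≡.cong suc k+l≡n)))

  antidiagonal-+ : ∀ n F G → antidiagonal n (λ k l → F k l + G k l) ≈
                             antidiagonal n F + antidiagonal n G
  antidiagonal-+ zero    F G = refl
  antidiagonal-+ (suc n) F G =
    trans (+-congˡ (antidiagonal-+ n (F ∘ suc) (G ∘ suc))) (interchange _ _ _ _)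

  *-distribˡ-antidiagonal : ∀ z n F → z * antidiagonal n F ≈ antidiagonal n (λ k l → z * F k l)
  *-distribˡ-antidiagonal z zero    F = refl
  *-distribˡ-antidiagonal z (suc n) F =
    trans (distribˡ z _ _) (+-congˡ (*-distribˡ-antidiagonal z n (F ∘ suc)))

  shiftˡ : (ℕ → ℕ → Carrier) → ℕ → ℕ → Carrier
  shiftˡ F zero    l = 0#
  shiftˡ F (suc k) l = F k l

  shiftʳ : (ℕ → ℕ → Carrier) → ℕ → ℕ → Carrier
  shiftʳ F k zero    = 0#
  shiftʳ F k (suc l) = F k l

  antidiagonal-shiftˡ : ∀ n F → antidiagonal (suc n) (shiftˡ F) ≈ antidiagonal n F
  antidiagonal-shiftˡ n F = +-identityˡ _

  antidiagonal-shiftʳ : ∀ n F → antidiagonal (suc n) (shiftʳ F) ≈ antidiagonal n F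
  antidiagonal-shiftʳ zero    F = +-identityʳ _
  antidiagonal-shiftʳ (suc n) F = +-congˡ (begin
    antidiagonal (suc n) (shiftʳ F ∘ suc)   ≈⟨ antidiagonal-cong (suc n) shift-suc ⟩
    antidiagonal (suc n) (shiftʳ (F ∘ suc)) ≈⟨ antidiagonal-shiftʳ n (F ∘ suc) ⟩
    antidiagonal n (F ∘ suc)                ∎)
    where
    shift-suc : ∀ k l → k ℕ.+ l ≡ suc n → shiftʳ F (suc k) l ≈ shiftʳ (F ∘ suc) k l
    shift-suc k zero    _ = refl
    shift-suc k (suc l) _ = refl

  antidiagonal-pascal : ∀ n {T} F G →
    (∀ k l → k ℕ.+ l ≡ suc n → T k l ≈ shiftˡ F k l + shiftʳ G k l) →
    antidiagonal (suc n) T ≈ antidiagonal n F + antidiagonal n G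
  antidiagonal-pascal n {T} F G T≈ = begin
    antidiagonal (suc n) T
      ≈⟨ antidiagonal-cong (suc n) T≈ ⟩
    antidiagonal (suc n) (λ k l → shiftˡ F k l + shiftʳ G k l)
      ≈⟨ antidiagonal-+ (suc n) (shiftˡ F) (shiftʳ G) ⟩
    antidiagonal (suc n) (shiftˡ F) + antidiagonal (suc n) (shiftʳ G)
      ≈⟨ +-cong (antidiagonal-shiftˡ n F) (antidiagonal-shiftʳ n G) ⟩
    antidiagonal n F + antidiagonal n G
      ∎

  module _ {P Q : Carrier → Carrier} (P-additive : IsAdditive P) (Q-additive : IsAdditive Q)
           (a : Carrier) where

    private
      eval : List Bool → Carrier
      eval w = evalWord R P Q w a

    SH-suc-zero : ∀ k → SH R (suc k) 0 P Q a ≈ P (SH R k 0 P Q a)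
    SH-suc-zero k = begin
      SH R (suc k) 0 P Q a     ≡⟨ ∑-map eval (true ∷_) (words k 0) ⟩
      ∑ (P ∘ eval) (words k 0) ≈⟨ additive-∑ P-additive eval (words k 0) ⟨
      P (SH R k 0 P Q a)       ∎

    SH-zero-suc : ∀ l → SH R 0 (suc l) P Q a ≈ Q (SH R 0 l P Q a)
    SH-zero-suc l = begin
      SH R 0 (suc l) P Q a     ≡⟨ ∑-map eval (false ∷_) (words 0 l) ⟩
      ∑ (Q ∘ eval) (words 0 l) ≈⟨ additive-∑ Q-additive eval (words 0 l) ⟨
      Q (SH R 0 l P Q a)       ∎

    SH-suc-suc : ∀ k l → SH R (suc k) (suc l) P Q a ≈
                         P (SH R k (suc l) P Q a) + Q (SH R (suc k) l P Q a)
    SH-suc-suc k l = begin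
      SH R (suc k) (suc l) P Q a
        ≈⟨ ∑-++ eval (map (true ∷_) (words k (suc l))) (map (false ∷_) (words (suc k) l)) ⟩
      ∑ eval (map (true ∷_) (words k (suc l))) + ∑ eval (map (false ∷_) (words (suc k) l))
        ≡⟨ ≡.cong₂ _+_ (∑-map eval (true ∷_) (words k (suc l)))
                       (∑-map eval (false ∷_) (words (suc k) l)) ⟩
      ∑ (P ∘ eval) (words k (suc l)) + ∑ (Q ∘ eval) (words (suc k) l)
        ≈⟨ +-cong (additive-∑ P-additive eval (words k (suc l)))
                  (additive-∑ Q-additive eval (words (suc k) l)) ⟨
      P (SH R k (suc l) P Q a) + Q (SH R (suc k) l P Q a) ∎

  module _ {P Q : Carrier → Carrier} (P-additive : IsAdditive P) (Q-additive : IsAdditive Q)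
           {z x : Carrier} (z*≈ : ∀ b → z * b ≈ P b + Q b * x) where

    *-pow-split : ∀ b l → z * (b * pow R x l) ≈ P b * pow R x l + Q b * pow R x (suc l)
    *-pow-split b l = begin
      z * (b * pow R x l)                     ≈⟨ *-assoc z b _ ⟨
      (z * b) * pow R x l                     ≈⟨ *-congʳ (z*≈ b) ⟩
      (P b + Q b * x) * pow R x l             ≈⟨ distribʳ _ _ _ ⟩
      P b * pow R x l + Q b * x * pow R x l   ≈⟨ +-congˡ (*-assoc _ _ _) ⟩
      P b * pow R x l + Q b * pow R x (suc l) ∎

    pow-*-antidiagonal-SH : ∀ n a →
      pow R z n * a ≈ antidiagonal n (λ k l → SH R k l P Q a * pow R x l)
    pow-*-antidiagonal-SH zero a = begin
      1# * a         ≈⟨ *-identityˡ a ⟩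
      a              ≈⟨ +-identityʳ a ⟨
      a + 0#         ≈⟨ *-identityʳ _ ⟨
      (a + 0#) * 1#  ∎
    pow-*-antidiagonal-SH (suc n) a = begin
      (z * pow R z n) * a                    ≈⟨ *-assoc _ _ _ ⟩
      z * (pow R z n * a)                    ≈⟨ *-congˡ (pow-*-antidiagonal-SH n a) ⟩
      z * antidiagonal n T                   ≈⟨ *-distribˡ-antidiagonal z n T ⟩
      antidiagonal n (λ k l → z * T k l)
        ≈⟨ antidiagonal-cong n (λ k l _ → *-pow-split (H k l) l) ⟩
      antidiagonal n (λ k l → F k l + G k l) ≈⟨ antidiagonal-+ n F G ⟩
      antidiagonal n F + antidiagonal n G    ≈⟨ antidiagonal-pascal n F G pascal ⟨
      antidiagonal (suc n) T                 ∎
      where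
      H T F G : ℕ → ℕ → Carrier
      H k l = SH R k l P Q a
      T k l = H k l * pow R x l
      F k l = P (H k l) * pow R x l
      G k l = Q (H k l) * pow R x (suc l)

      pascal : ∀ k l → k ℕ.+ l ≡ suc n → T k l ≈ shiftˡ F k l + shiftʳ G k l
      pascal zero    zero    ()
      pascal (suc k) zero    _ = trans (*-congʳ (SH-suc-zero P-additive Q-additive a k))
                                       (sym (+-identityʳ _))
      pascal zero    (suc l) _ = trans (*-congʳ (SH-zero-suc P-additive Q-additive a l))
                                       (sym (+-identityˡ _))
      pascal (suc k) (suc l) _ = trans (*-congʳ (SH-suc-suc P-additive Q-additive a k l))
                                       (distribʳ _ _ _)

  module _ {σ : Carrier → Carrier} (σ-additive : IsAdditive σ) (x y : Carrier) where
    open Additive σ-additive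
      renaming (⟦⟧-cong to σ-cong; homo to σ-+; ε-homo to σ-0#)

    adσ+-additive : IsAdditive (adσ+ R σ x y)
    adσ+-additive = record
      { isMagmaHomomorphism = record
        { isRelHomomorphism = record { cong = adσ+-cong }
        ; homo              = adσ+-+
        }
      ; ε-homo = adσ+-0#
      }
      where
      adσ+-cong : ∀ {a b} → a ≈ b → adσ+ R σ x y a ≈ adσ+ R σ x y b
      adσ+-cong a≈b = +-cong (+-cong (*-congˡ a≈b) (-‿cong (*-congʳ (σ-cong a≈b)))) (*-congˡ a≈b)

      adσ+-+ : ∀ a b → adσ+ R σ x y (a + b) ≈ adσ+ R σ x y a + adσ+ R σ x y b
      adσ+-+ a b = begin
        x * (a + b) - σ (a + b) * x + y * (a + b)
          ≈⟨ +-cong (+-cong (distribˡ x a b) (-‿cong (trans (*-congʳ (σ-+ a b)) (distribʳ x _ _))))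
                    (distribˡ y a b) ⟩
        (x * a + x * b) - (σ a * x + σ b * x) + (y * a + y * b)
          ≈⟨ +-congʳ (+-congˡ (-‿+-comm _ _)) ⟨
        (x * a + x * b) + (- (σ a * x) + - (σ b * x)) + (y * a + y * b)
          ≈⟨ +-congʳ (interchange _ _ _ _) ⟩
        (x * a - σ a * x) + (x * b - σ b * x) + (y * a + y * b)
          ≈⟨ interchange _ _ _ _ ⟩
        adσ+ R σ x y a + adσ+ R σ x y b ∎

      adσ+-0# : adσ+ R σ x y 0# ≈ 0#
      adσ+-0# = begin
        x * 0# - σ 0# * x + y * 0#
          ≈⟨ +-cong (+-cong (zeroʳ x) (-‿cong (trans (*-congʳ σ-0#) (zeroˡ x)))) (zeroʳ y) ⟩
        0# - 0# + 0# ≈⟨ +-identityʳ _ ⟩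
        0# - 0#      ≈⟨ -‿inverseʳ 0# ⟩
        0#           ∎

    +-*-adσ+ : ∀ a → (x + y) * a ≈ adσ+ R σ x y a + σ a * x
    +-*-adσ+ a = begin
      (x + y) * a                               ≈⟨ distribʳ a x y ⟩
      x * a + y * a                             ≈⟨ +-congʳ (+-identityʳ _) ⟨
      x * a + 0# + y * a                        ≈⟨ +-congʳ (+-congˡ (-‿inverseˡ (σ a * x))) ⟨
      x * a + (- (σ a * x) + σ a * x) + y * a   ≈⟨ +-congʳ (+-assoc _ _ _) ⟨
      (x * a - σ a * x) + σ a * x + y * a       ≈⟨ xy∙z≈xz∙y _ _ _ ⟩
      adσ+ R σ x y a + σ a * x                  ∎

theoremB : ∀ {c ℓ} (R : Ring c ℓ) (x y : Ring.Carrier R)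
    (σ : Ring.Carrier R → Ring.Carrier R)
    → RingMorphisms.IsRingHomomorphism (Ring.rawRing R) (Ring.rawRing R) σ
    → (n : ℕ)
    → Ring._≈_ R (pow R (Ring._+_ R x y) n)
        (sumTo R n (λ k → Ring._*_ R (SH R k (n ∸ k) (adσ+ R σ x y) σ (Ring.1# R)) (pow R x (n ∸ k))))
theoremB R x y σ σ-hom n = begin
  pow R (x + y) n
    ≈⟨ *-identityʳ _ ⟨
  pow R (x + y) n * 1#
    ≈⟨ pow-*-antidiagonal-SH R (adσ+-additive R σ-additive x y) σ-additive
                              (+-*-adσ+ R σ-additive x y) n 1# ⟩
  antidiagonal R n (λ k l → SH R k l (adσ+ R σ x y) σ 1# * pow R x l)
    ≈⟨ sumTo-antidiagonal R n _ ⟨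
  sumTo R n (λ k → SH R k (n ∸ k) (adσ+ R σ x y) σ 1# * pow R x (n ∸ k)) ∎
  where
  open Ring R
  open SetoidReasoning setoid
  open RingMorphisms.IsRingHomomorphism σ-hom
    using () renaming (+-isMonoidHomomorphism to σ-additive)
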